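{- Let $\mathcal P=(\mathcal C,\mathcal A)$ be a palette with $n=|\mathcal C|\ge 2$ colors such that for every color $a\in\mathcal C$, the palette $\mathcal P'_a=(\mathcal C\setminus\{a\},(\mathcal C\setminus\{a\})^3\cap\mathcal A)$ obtained by removing $a$ satisfies $d(\mathcal P'_a)<d(\mathcal P)$. Then for every $a\in\mathcal C$ and all distinct $i,j\in\{1,2,3\}$, \[e_{i,j}(a)\ge 3d(\mathcal P)-2.\]
   Context: A palette $\mathcal P=(\mathcal C,\mathcal A)$ consists of a finite set $\mathcal C$ of colors and a set $\mathcal A\subseteq\mathcal C^3$ of ordered triples (admissible triples); its density is $d(\mathcal P)=|\mathcal A|/|\mathcal C|^3$. For colors $a,b\in\mathcal C$ and distinct $i,j\in\{1,2,3\}$, the pair $(a,b)$ is called $(i,j)$-good if there exists $(c_1,c_2,c_3)\in\mathcal A$ with $c_i=a$ and $c_j=b$. Let $d_{i,j}(a)$ be the number of colors $b\in\mathcal C$ such that $(a,b)$ is $(i,j)$-good, and $e_{i,j}(a)=d_{i,j}(a)/|\mathcal C|$. -}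

module Defs where

open import Data.Nat using (ℕ; zero; suc; _+_; _^_; NonZero)
open import Data.Nat.Properties using (m^n≢0)
open import Data.Fin using (Fin; zero; suc; punchIn)
open import Data.Fin.Properties using (any?; _≟_)
open import Data.Vec using (Vec; []; _∷_; lookup; allFin; count)
open import Data.Bool using (Bool; true; false; if_then_else_; _≟_)
open import Data.Product using (Σ; _×_; _,_; ∃)
open import Data.Integer using (+_)
open import Data.Rational using (ℚ; _/_)
open import Relation.Binary.PropositionalEquality using (_≡_)
open import Relation.Nullary using (Dec)
open import Relation.Nullary.Decidable using (_×-dec_)

-- The admissible set
-- A ⊆ C³ is given by its (decidable) characteristic function on
-- ordered triples (c₁ , c₂ , c₃), represented as vectors of length 3,
-- so that the i-th coordinate is  lookup t i  with i : Fin 3.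
record Palette (n : ℕ) : Set where
  field
    admissible : Vec (Fin n) 3 → Bool

open Palette public

triple : ∀ {n} → Fin n → Fin n → Fin n → Vec (Fin n) 3
triple c₁ c₂ c₃ = c₁ ∷ c₂ ∷ c₃ ∷ []

∑ : (n : ℕ) → (Fin n → ℕ) → ℕ
∑ zero    f = 0
∑ (suc n) f = f zero + ∑ n (λ i → f (suc i))

size : ∀ {n} → Palette n → ℕ
size {n} P = ∑ n λ c₁ → ∑ n λ c₂ → ∑ n λ c₃ →
  if admissible P (triple c₁ c₂ c₃) then 1 else 0

density : ∀ {n} .{{_ : NonZero n}} → Palette n → ℚ
density {n} P = (+ size P) / (n ^ 3)
  where instance _ = m^n≢0 n 3

-- The palette obtained by removing colour a : the colours C \ {a}
-- are identified with Fin n via the order-preserving bijection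
-- punchIn a : Fin n → Fin (suc n) \ {a}; the admissible triples are
-- those of A all of whose entries lie in C \ {a}.
remove : ∀ {n} → Palette (suc n) → Fin (suc n) → Palette n
remove P a = record
  { admissible = λ t → admissible P (Data.Vec.map (punchIn a) t) }

Good : ∀ {n} → Palette n → Fin 3 → Fin 3 → Fin n → Fin n → Set
Good {n} P i j a b =
  ∃ λ c₁ → ∃ λ c₂ → ∃ λ (c₃ : Fin n) →
    (admissible P (triple c₁ c₂ c₃) ≡ true)
    × (lookup (triple c₁ c₂ c₃) i ≡ a)
    × (lookup (triple c₁ c₂ c₃) j ≡ b)

good? : ∀ {n} (P : Palette n) i j a b → Dec (Good P i j a b)
good? P i j a b =
  any? λ c₁ → any? λ c₂ → any? λ c₃ →
    (admissible P (triple c₁ c₂ c₃) Data.Bool.≟ true)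
    ×-dec ((lookup (triple c₁ c₂ c₃) i Data.Fin.Properties.≟ a)
    ×-dec (lookup (triple c₁ c₂ c₃) j Data.Fin.Properties.≟ b))

dgood : ∀ {n} → Palette n → Fin 3 → Fin 3 → Fin n → ℕ
dgood {n} P i j a = count (good? P i j a) (allFin n)

egood : ∀ {n} .{{_ : NonZero n}} → Palette n → Fin 3 → Fin 3 → Fin n → ℚ
egood {n} P i j a = (+ dgood P i j a) / n

{-# OPTIONS --safe #-}
-- Write n = |C|, S = |A|, S′ = |A′ₐ| and D = d_{i,j}(a).  An admissible triple
-- either avoids a (S′ of them), or has cᵢ = a (at most n D of them, as cⱼ must
-- be an (i,j)-partner of a), or has cᵢ ≠ a and a among its other two entries
-- (at most (n-1)(2n-1) of them).  Hence S ≤ S′ + n D + (n-1)(2n-1).  The drop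
-- in density gives S′ n³ < S (n-1)³, and together with S ≤ n³ this clears to
-- 3 S n ≤ D n³ + 2 n⁴, which is the claim.
module Submission where

open import Defs

module Counting where

  open import Algebra.Definitions.RawMagma using (_,_)
  open import Data.Bool using (Bool; true; false; if_then_else_)
  open import Data.Empty using (⊥-elim)
  open import Data.Fin using (Fin; zero; suc; punchIn)
  open import Data.Fin.Patterns using (0F; 1F; 2F)
  open import Data.Nat using (ℕ; zero; suc; _+_; _*_; _^_; _≤_; _<_; z≤n)
  open import Data.Nat.Properties
    using ( +-*-semiring; +-assoc; +-comm; *-distribˡ-+; *-distribʳ-+
          ; ≤-refl; ≤-trans; ≤-reflexive; <⇒≤; m≤m+n; ≤⇒≤″
          ; +-mono-≤; +-monoˡ-≤; +-monoʳ-≤; +-monoʳ-<; *-monoˡ-≤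
          ; +-cancelˡ-<; +-cancelʳ-<; *-cancelˡ-<; module ≤-Reasoning )
  open import Data.Nat.Tactic.RingSolver using (solve-∀)
  open import Data.Product using (_×_; _,_; proj₁; proj₂)
  open import Data.Vec using (Vec; []; _∷_; lookup; tabulate; count)
  open import Function using (id)
  open import Level using (0ℓ)
  open import Relation.Binary.PropositionalEquality
    using (_≡_; _≢_; refl; sym; trans; cong)
  open import Relation.Nullary using (Dec; yes; no; does)
  open import Relation.Unary using (Pred; Decidable)
  open import Algebra.Properties.Semiring.Sum +-*-semiring
    using (sum; sum-remove; ∑-comm; ∑-distrib-+; sum-cong-≗; *-distribˡ-sum)

  ∑≡sum : ∀ n (f : Fin n → ℕ) → ∑ n f ≡ sum f
  ∑≡sum zero    f = refl
  ∑≡sum (suc n) f = cong (f zero +_) (∑≡sum n (λ i → f (suc i)))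

  ∑³ : ∀ {n} → (Fin n → Fin n → Fin n → ℕ) → ℕ
  ∑³ F = sum λ x → sum λ y → sum λ z → F x y z

  ∑∑∑≡∑³ : ∀ n (F : Fin n → Fin n → Fin n → ℕ) →
    ∑ n (λ x → ∑ n λ y → ∑ n λ z → F x y z) ≡ ∑³ F
  ∑∑∑≡∑³ n F = trans (∑≡sum n _) (sum-cong-≗ λ x →
               trans (∑≡sum n _) (sum-cong-≗ λ y → ∑≡sum n (F x y)))

  ∑³-swap₁₂ : ∀ {n} (F : Fin n → Fin n → Fin n → ℕ) → ∑³ F ≡ ∑³ (λ x y z → F y x z)
  ∑³-swap₁₂ F = ∑-comm (λ x y → sum (F x y))

  ∑³-swap₂₃ : ∀ {n} (F : Fin n → Fin n → Fin n → ℕ) → ∑³ F ≡ ∑³ (λ x y z → F x z y)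
  ∑³-swap₂₃ F = sum-cong-≗ (λ x → ∑-comm (F x))

  sum-mono-≤ : ∀ {n} {f g : Fin n → ℕ} → (∀ i → f i ≤ g i) → sum f ≤ sum g
  sum-mono-≤ {zero}  f≤g = z≤n
  sum-mono-≤ {suc n} f≤g = +-mono-≤ (f≤g zero) (sum-mono-≤ λ i → f≤g (suc i))

  sum-≤-* : ∀ {n} {f : Fin n → ℕ} {c} → (∀ i → f i ≤ c) → sum f ≤ n * c
  sum-≤-* {zero}  f≤c = z≤n
  sum-≤-* {suc n} f≤c = +-mono-≤ (f≤c zero) (sum-≤-* λ i → f≤c (suc i))

  sum-≤-*-+ : ∀ {n} {f g : Fin n → ℕ} {c} → (∀ i → f i ≤ c + g i) → sum f ≤ n * c + sum g
  sum-≤-*-+ {n} {f} {g} {c} f≤c+g = begin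
    sum f                     ≤⟨ sum-mono-≤ f≤c+g ⟩
    sum (λ i → c + g i)       ≡⟨ ∑-distrib-+ {n} (λ _ → c) g ⟩
    sum {n} (λ _ → c) + sum g ≤⟨ +-monoˡ-≤ (sum g) (sum-≤-* {n} λ _ → ≤-refl) ⟩
    n * c + sum g             ∎
    where open ≤-Reasoning

  module _ {m : ℕ} (a : Fin (suc m)) where

    square-removeAt-≤ : (g : Fin (suc m) → Fin (suc m) → ℕ) → (∀ y z → g y z ≤ 1) →
      sum (λ y → sum (g y)) ≤ (suc m + m) + sum (λ y → sum λ z → g (punchIn a y) (punchIn a z))
    square-removeAt-≤ g g≤1 = begin
      sum (λ y → sum (g y))                          ≡⟨ sum-remove {i = a} (λ y → sum (g y)) ⟩
      sum (g a) + sum (λ y → sum (g (punchIn a y))) ≤⟨ +-mono-≤ (sum-≤-* (g≤1 a)) (sum-≤-*-+ row-≤) ⟩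
      suc m * 1 + (m * 1 + s)                        ≡⟨ regroup m s ⟩
      (suc m + m) + s                                ∎
      where
      open ≤-Reasoning
      s : ℕ
      s = sum (λ y → sum λ z → g (punchIn a y) (punchIn a z))
      regroup : ∀ m s → suc m * 1 + (m * 1 + s) ≡ (suc m + m) + s
      regroup = solve-∀
      row-≤ : ∀ y → sum (g (punchIn a y)) ≤ 1 + sum (λ z → g (punchIn a y) (punchIn a z))
      row-≤ y = begin
        sum (g (punchIn a y))                                          ≡⟨ sum-remove {i = a} (g (punchIn a y)) ⟩
        g (punchIn a y) a + sum (λ z → g (punchIn a y) (punchIn a z)) ≤⟨ +-monoˡ-≤ _ (g≤1 _ a) ⟩
        1 + sum (λ z → g (punchIn a y) (punchIn a z))                 ∎

    cube-removeAt-≤ : (h : Fin (suc m) → Fin (suc m) → Fin (suc m) → ℕ) → (∀ x y z → h x y z ≤ 1) →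
      ∑³ h ≤ sum (λ y → sum (h a y)) + m * (suc m + m)
             + ∑³ (λ x y z → h (punchIn a x) (punchIn a y) (punchIn a z))
    cube-removeAt-≤ h h≤1 = begin
      ∑³ h
        ≡⟨ sum-remove {i = a} (λ x → sum λ y → sum (h x y)) ⟩
      sum (λ y → sum (h a y)) + sum (λ x → sum λ y → sum (h (punchIn a x) y))
        ≤⟨ +-monoʳ-≤ _ (sum-≤-*-+ λ x → square-removeAt-≤ (h (punchIn a x)) (h≤1 (punchIn a x))) ⟩
      sum (λ y → sum (h a y)) + (m * (suc m + m) + ∑³ h∘π³)
        ≡⟨ +-assoc (sum (λ y → sum (h a y))) _ _ ⟨
      sum (λ y → sum (h a y)) + m * (suc m + m) + ∑³ h∘π³ ∎
      where
      open ≤-Reasoning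
      h∘π³ : Fin m → Fin m → Fin m → ℕ
      h∘π³ x y z = h (punchIn a x) (punchIn a y) (punchIn a z)

  -- arrange i j x y z puts x at position i, y at position j and z at the
  -- remaining one (junk value for i ≡ j).
  arrange : ∀ {A : Set} → Fin 3 → Fin 3 → A → A → A → Vec A 3
  arrange 0F 1F x y z = x ∷ y ∷ z ∷ []
  arrange 0F 2F x y z = x ∷ z ∷ y ∷ []
  arrange 1F 0F x y z = y ∷ x ∷ z ∷ []
  arrange 1F 2F x y z = z ∷ x ∷ y ∷ []
  arrange 2F 0F x y z = y ∷ z ∷ x ∷ []
  arrange 2F 1F x y z = z ∷ y ∷ x ∷ []
  arrange _  _  x y z = x ∷ y ∷ z ∷ []

  lookup-arrange : ∀ {A : Set} {i j : Fin 3} → i ≢ j → (x y z : A) →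
    lookup (arrange i j x y z) i ≡ x × lookup (arrange i j x y z) j ≡ y
  lookup-arrange {i = 0F} {0F} i≢j _ _ _ = ⊥-elim (i≢j refl)
  lookup-arrange {i = 0F} {1F} _   _ _ _ = refl , refl
  lookup-arrange {i = 0F} {2F} _   _ _ _ = refl , refl
  lookup-arrange {i = 1F} {0F} _   _ _ _ = refl , refl
  lookup-arrange {i = 1F} {1F} i≢j _ _ _ = ⊥-elim (i≢j refl)
  lookup-arrange {i = 1F} {2F} _   _ _ _ = refl , refl
  lookup-arrange {i = 2F} {0F} _   _ _ _ = refl , refl
  lookup-arrange {i = 2F} {1F} _   _ _ _ = refl , refl
  lookup-arrange {i = 2F} {2F} i≢j _ _ _ = ⊥-elim (i≢j refl)

  ∑³-arrange : ∀ {m} {A : Set} (i j : Fin 3) (F : Vec A 3 → ℕ) (f : Fin m → A) →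
    ∑³ (λ x y z → F (arrange i j (f x) (f y) (f z))) ≡ ∑³ (λ x y z → F (f x ∷ f y ∷ f z ∷ []))
  ∑³-arrange 0F 0F F f = refl
  ∑³-arrange 0F 1F F f = refl
  ∑³-arrange 0F 2F F f = sym (∑³-swap₂₃ λ x y z → F (f x ∷ f y ∷ f z ∷ []))
  ∑³-arrange 1F 0F F f = sym (∑³-swap₁₂ λ x y z → F (f x ∷ f y ∷ f z ∷ []))
  ∑³-arrange 1F 1F F f = refl
  ∑³-arrange 1F 2F F f = trans (∑³-swap₂₃ λ x y z → F (f z ∷ f x ∷ f y ∷ []))
                               (∑³-swap₁₂ λ x y z → F (f y ∷ f x ∷ f z ∷ []))
  ∑³-arrange 2F 0F F f = trans (∑³-swap₁₂ λ x y z → F (f y ∷ f z ∷ f x ∷ []))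
                               (∑³-swap₂₃ λ x y z → F (f x ∷ f z ∷ f y ∷ []))
  ∑³-arrange 2F 1F F f = trans (∑³-swap₂₃ λ x y z → F (f z ∷ f y ∷ f x ∷ []))
                        (trans (∑³-swap₁₂ λ x y z → F (f y ∷ f z ∷ f x ∷ []))
                               (∑³-swap₂₃ λ x y z → F (f x ∷ f z ∷ f y ∷ [])))
  ∑³-arrange 2F 2F F f = refl

  𝟙 : Bool → ℕ
  𝟙 b = if b then 1 else 0

  𝟙≤1 : ∀ b → 𝟙 b ≤ 1
  𝟙≤1 true  = ≤-refl
  𝟙≤1 false = z≤n

  𝟙-≤-does : ∀ {b} {Q : Set} (Q? : Dec Q) → (b ≡ true → Q) → 𝟙 b ≤ 𝟙 (does Q?)
  𝟙-≤-does {false} _       _   = z≤n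
  𝟙-≤-does {true}  (yes _) _   = ≤-refl
  𝟙-≤-does {true}  (no ¬q) b⇒q = ⊥-elim (¬q (b⇒q refl))

  count-tabulate : ∀ {n} {A : Set} {P : Pred A 0ℓ} (P? : Decidable P) (f : Fin n → A) →
    count P? (tabulate f) ≡ sum (λ k → 𝟙 (does (P? (f k))))
  count-tabulate {zero}  P? f = refl
  count-tabulate {suc n} P? f with does (P? (f zero))
  ... | true  = cong suc (count-tabulate P? (λ k → f (suc k)))
  ... | false = count-tabulate P? (λ k → f (suc k))

  size≡∑³ : ∀ {n} (P : Palette n) → size P ≡ ∑³ (λ x y z → 𝟙 (admissible P (x ∷ y ∷ z ∷ [])))
  size≡∑³ {n} P = ∑∑∑≡∑³ n λ x y z → 𝟙 (admissible P (x ∷ y ∷ z ∷ []))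

  size≤n³ : ∀ {n} (P : Palette n) → size P ≤ n ^ 3
  size≤n³ {n} P = ≤-trans (≤-reflexive (size≡∑³ P))
                          (sum-≤-* {n} λ _ → sum-≤-* {n} λ _ → sum-≤-* {n} λ _ → 𝟙≤1 _)

  dgood≡sum : ∀ {n} (P : Palette n) i j a → dgood P i j a ≡ sum (λ b → 𝟙 (does (good? P i j a b)))
  dgood≡sum P i j a = count-tabulate (good? P i j a) id

  good-intro : ∀ {n} (P : Palette n) {i j a b} (t : Vec (Fin n) 3) →
    admissible P t ≡ true → lookup t i ≡ a → lookup t j ≡ b → Good P i j a b
  good-intro P (x ∷ y ∷ z ∷ []) adm tᵢ≡a tⱼ≡b = x , y , z , adm , tᵢ≡a , tⱼ≡b

  size-≤-remove : ∀ {m} (P : Palette (suc m)) (a : Fin (suc m)) (i j : Fin 3) → i ≢ j →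
    size P ≤ suc m * dgood P i j a + m * (suc m + m) + size (remove P a)
  size-≤-remove {m} P a i j i≢j = begin
    size P                                  ≡⟨ size≡∑³ P ⟩
    ∑³ (λ x y z → 𝟙A (x ∷ y ∷ z ∷ []))      ≡⟨ ∑³-arrange i j 𝟙A id ⟨
    ∑³ h                                    ≤⟨ cube-removeAt-≤ a h (λ _ _ _ → 𝟙≤1 _) ⟩
    sum (λ y → sum (h a y)) + m * (suc m + m) + ∑³ (λ x y z → h (π x) (π y) (π z))
      ≤⟨ +-monoˡ-≤ _ (+-monoˡ-≤ _ pairs-at-a) ⟩
    suc m * dgood P i j a + m * (suc m + m) + ∑³ (λ x y z → h (π x) (π y) (π z))
      ≡⟨ cong (suc m * dgood P i j a + m * (suc m + m) +_)
              (trans (∑³-arrange i j 𝟙A π) (sym (size≡∑³ (remove P a)))) ⟩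
    suc m * dgood P i j a + m * (suc m + m) + size (remove P a) ∎
    where
    open ≤-Reasoning
    π : Fin m → Fin (suc m)
    π = punchIn a
    𝟙A : Vec (Fin (suc m)) 3 → ℕ
    𝟙A t = 𝟙 (admissible P t)
    h : Fin (suc m) → Fin (suc m) → Fin (suc m) → ℕ
    h x y z = 𝟙A (arrange i j x y z)
    good-a : Fin (suc m) → ℕ
    good-a b = 𝟙 (does (good? P i j a b))
    h≤good-a : ∀ y z → h a y z ≤ good-a y
    h≤good-a y z = 𝟙-≤-does (good? P i j a y) λ adm →
      good-intro P (arrange i j a y z) adm (proj₁ (lookup-arrange i≢j a y z)) (proj₂ (lookup-arrange i≢j a y z))
    pairs-at-a : sum (λ y → sum (h a y)) ≤ suc m * dgood P i j a
    pairs-at-a = begin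
      sum (λ y → sum (h a y))      ≤⟨ sum-mono-≤ (λ y → sum-≤-* (h≤good-a y)) ⟩
      sum (λ y → suc m * good-a y) ≡⟨ *-distribˡ-sum (suc m) good-a ⟨
      suc m * sum good-a           ≡⟨ cong (suc m *_) (dgood≡sum P i j a) ⟨
      suc m * dgood P i j a        ∎

  cube-split : ∀ m → suc m ^ 3 ≡ m ^ 3 + (suc m * suc m + m * (suc m + m))
  cube-split m = expanded m
    where
    expanded : ∀ m → suc m * (suc m * (suc m * 1)) ≡ m * (m * (m * 1)) + (suc m * suc m + m * (suc m + m))
    expanded = solve-∀

  N≡M+K⇒S*K<E*N : ∀ {N M K S S′ E} → N ≡ M + K → S′ * N < S * M → S ≤ E + S′ → S * K < E * N
  N≡M+K⇒S*K<E*N {N} {M} {K} {S} {S′} {E} N≡M+K S′N<SM S≤E+S′ =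
    +-cancelˡ-< (S * M) (S * K) (E * N) (begin-strict
      S * M + S * K  ≡⟨ *-distribˡ-+ S M K ⟨
      S * (M + K)    ≡⟨ cong (S *_) N≡M+K ⟨
      S * N          ≤⟨ *-monoˡ-≤ N S≤E+S′ ⟩
      (E + S′) * N   ≡⟨ *-distribʳ-+ N E S′ ⟩
      E * N + S′ * N <⟨ +-monoʳ-< (E * N) S′N<SM ⟩
      E * N + S * M  ≡⟨ +-comm (E * N) (S * M) ⟩
      S * M + E * N  ∎)
    where open ≤-Reasoning

  -- Writing N = S + X, the conclusion times suc m exceeds the hypothesis by
  -- exactly X (3m + 2) ≥ 0.
  3*S*n≤D*N+2*N*n : ∀ m S D N → S ≤ N →
    S * (suc m * suc m + m * (suc m + m)) < (suc m * D + m * (suc m + m)) * N →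
    3 * S * suc m ≤ D * N + 2 * N * suc m
  3*S*n≤D*N+2*N*n m S D N S≤N lt with ≤⇒≤″ S≤N
  ... | X , refl = <⇒≤ (*-cancelˡ-< (suc m) _ _ (+-cancelʳ-< _ _ _ (begin-strict
    suc m * (3 * S * suc m) + m * (suc m + m) * (S + X)
      ≤⟨ +-monoˡ-≤ (m * (suc m + m) * (S + X)) (m≤m+n (suc m * (3 * S * suc m)) (X * (3 * m + 2))) ⟩
    suc m * (3 * S * suc m) + X * (3 * m + 2) + m * (suc m + m) * (S + X)
      ≡⟨ regroup₁ m S X ⟩
    suc m * (2 * (S + X) * suc m) + S * (suc m * suc m + m * (suc m + m))
      <⟨ +-monoʳ-< _ lt ⟩
    suc m * (2 * (S + X) * suc m) + (suc m * D + m * (suc m + m)) * (S + X)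
      ≡⟨ regroup₂ m S X D ⟩
    suc m * (D * (S + X) + 2 * (S + X) * suc m) + m * (suc m + m) * (S + X) ∎)))
    where
    open ≤-Reasoning
    regroup₁ : ∀ m S X → suc m * (3 * S * suc m) + X * (3 * m + 2) + m * (suc m + m) * (S + X)
                       ≡ suc m * (2 * (S + X) * suc m) + S * (suc m * suc m + m * (suc m + m))
    regroup₁ = solve-∀
    regroup₂ : ∀ m S X D → suc m * (2 * (S + X) * suc m) + (suc m * D + m * (suc m + m)) * (S + X)
                         ≡ suc m * (D * (S + X) + 2 * (S + X) * suc m) + m * (suc m + m) * (S + X)
    regroup₂ = solve-∀

  density-drop⇒3*S*n≤D*n³+2*n³*n : ∀ m S S′ D →
    S′ * suc m ^ 3 < S * m ^ 3 → S ≤ suc m * D + m * (suc m + m) + S′ → S ≤ suc m ^ 3 →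
    3 * S * suc m ≤ D * suc m ^ 3 + 2 * suc m ^ 3 * suc m
  density-drop⇒3*S*n≤D*n³+2*n³*n m S S′ D S′n³<Sm³ S≤nD+c+S′ S≤n³ =
    3*S*n≤D*N+2*N*n m S D (suc m ^ 3) S≤n³
      (N≡M+K⇒S*K<E*N {S′ = S′} {E = suc m * D + m * (suc m + m)} (cube-split m) S′n³<Sm³ S≤nD+c+S′)

open Counting using (size-≤-remove; size≤n³; density-drop⇒3*S*n≤D*n³+2*n³*n)

open import Data.Nat as ℕ using (ℕ; suc; pred; NonZero)
import Data.Nat.Properties as ℕ
open import Data.Fin using (Fin)
open import Data.Integer as ℤ using (+_)
import Data.Integer.Properties as ℤ
import Data.Integer.Tactic.RingSolver as ℤ-Solver
open import Data.Rational using (_/_; _*_; _-_; _≤_; _<_; toℚᵘ)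
open import Data.Rational.Properties
  using (toℚᵘ-fromℚᵘ; toℚᵘ-mono-<; toℚᵘ-cancel-≤; toℚᵘ-homo-+; toℚᵘ-homo-*; toℚᵘ-homo‿-)
open import Data.Rational.Unnormalised as ℚᵘ using (mkℚᵘ; *≤*; *<*) renaming (_≃_ to _≃ᵘ_)
import Data.Rational.Unnormalised.Properties as ℚᵘ
open import Relation.Binary.PropositionalEquality
  using (_≡_; _≢_; sym; trans; cong; cong₂; subst; subst₂)

toℚᵘ-/ : ∀ i d .{{_ : NonZero d}} → toℚᵘ (i / d) ≃ᵘ mkℚᵘ i (pred d)
toℚᵘ-/ i (suc d) = toℚᵘ-fromℚᵘ (mkℚᵘ i d)

/<⇒*< : ∀ p q r s .{{_ : NonZero q}} .{{_ : NonZero s}} → + p / q < + r / s → p ℕ.* s ℕ.< r ℕ.* q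
/<⇒*< p q@(suc _) r s@(suc _) p/q<r/s
  with ℚᵘ.<-respˡ-≃ (toℚᵘ-/ (+ p) q) (ℚᵘ.<-respʳ-≃ (toℚᵘ-/ (+ r) s) (toℚᵘ-mono-< p/q<r/s))
... | *<* ps<rq = ℤ.drop‿+<+ (subst₂ ℤ._<_ (sym (ℤ.pos-* p s)) (sym (ℤ.pos-* r q)) ps<rq)

i≤j+k⇒i-k≤j : ∀ {i} j k → i ℤ.≤ j ℤ.+ k → i ℤ.- k ℤ.≤ j
i≤j+k⇒i-k≤j j k i≤j+k = ℤ.≤-trans (ℤ.+-monoˡ-≤ (ℤ.- k) i≤j+k) (ℤ.≤-reflexive (cancel j k))
  where
  cancel : ∀ j k → j ℤ.+ k ℤ.- k ≡ j
  cancel = ℤ-Solver.solve-∀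

pos-*³ : ∀ a b c → + a ℤ.* + b ℤ.* + c ≡ + (a ℕ.* b ℕ.* c)
pos-*³ a b c = trans (cong (ℤ._* + c) (sym (ℤ.pos-* a b))) (sym (ℤ.pos-* (a ℕ.* b) c))

affine-/-≤ : ∀ c b p q r s .{{_ : NonZero q}} .{{_ : NonZero s}} →
  c ℕ.* p ℕ.* s ℕ.≤ r ℕ.* q ℕ.+ b ℕ.* q ℕ.* s → (+ c / 1) * (+ p / q) - (+ b / 1) ≤ + r / s
affine-/-≤ c b p q@(suc q-1) r s@(suc _) cps≤rq+bqs =
  toℚᵘ-cancel-≤ (ℚᵘ.≤-respˡ-≃ (ℚᵘ.≃-sym lhs) (ℚᵘ.≤-respʳ-≃ (ℚᵘ.≃-sym (toℚᵘ-/ (+ r) s)) (*≤* cross)))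
  where
  lhs : toℚᵘ ((+ c / 1) * (+ p / q) - (+ b / 1)) ≃ᵘ mkℚᵘ (+ c) 0 ℚᵘ.* mkℚᵘ (+ p) q-1 ℚᵘ.- mkℚᵘ (+ b) 0
  lhs = ℚᵘ.≃-trans (toℚᵘ-homo-+ ((+ c / 1) * (+ p / q)) (Data.Rational.- (+ b / 1)))
          (ℚᵘ.+-cong (ℚᵘ.≃-trans (toℚᵘ-homo-* (+ c / 1) (+ p / q)) (ℚᵘ.*-cong (toℚᵘ-/ (+ c) 1) (toℚᵘ-/ (+ p) q)))
                     (ℚᵘ.≃-trans (toℚᵘ-homo‿- (+ b / 1)) (ℚᵘ.-‿cong (toℚᵘ-/ (+ b) 1))))
  -- ℚᵘ arithmetic leaves the denominator q in the unreduced form 1 * q.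
  Q = 1 ℕ.* q
  expand : ∀ c p b Q s → (c ℤ.* p ℤ.* + 1 ℤ.+ ℤ.- b ℤ.* Q) ℤ.* s ≡ c ℤ.* p ℤ.* s ℤ.- b ℤ.* Q ℤ.* s
  expand = ℤ-Solver.solve-∀
  cpsQ≤rQ+bQs : c ℕ.* p ℕ.* s ℕ.≤ r ℕ.* Q ℕ.+ b ℕ.* Q ℕ.* s
  cpsQ≤rQ+bQs = subst (λ t → c ℕ.* p ℕ.* s ℕ.≤ r ℕ.* t ℕ.+ b ℕ.* t ℕ.* s) (sym (ℕ.*-identityˡ q)) cps≤rq+bqs
  cross : (+ c ℤ.* + p ℤ.* + 1 ℤ.+ ℤ.- + b ℤ.* + Q) ℤ.* + s ℤ.≤ + r ℤ.* + (Q ℕ.* 1)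
  cross = begin
    (+ c ℤ.* + p ℤ.* + 1 ℤ.+ ℤ.- + b ℤ.* + Q) ℤ.* + s ≡⟨ expand (+ c) (+ p) (+ b) (+ Q) (+ s) ⟩
    + c ℤ.* + p ℤ.* + s ℤ.- + b ℤ.* + Q ℤ.* + s      ≡⟨ cong₂ ℤ._-_ (pos-*³ c p s) (pos-*³ b Q s) ⟩
    + (c ℕ.* p ℕ.* s) ℤ.- + (b ℕ.* Q ℕ.* s)          ≤⟨ i≤j+k⇒i-k≤j (+ (r ℕ.* Q)) (+ (b ℕ.* Q ℕ.* s)) (ℤ.+≤+ cpsQ≤rQ+bQs) ⟩
    + (r ℕ.* Q)                                      ≡⟨ ℤ.pos-* r Q ⟩
    + r ℤ.* + Q                                      ≡⟨ cong (λ t → + r ℤ.* + t) (ℕ.*-identityʳ Q) ⟨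
    + r ℤ.* + (Q ℕ.* 1)                              ∎
    where open ℤ.≤-Reasoning

claim2p1 : (k : ℕ) (P : Palette (suc (suc k)))
    → ((a : Fin (suc (suc k))) → density (remove P a) < density P)
    → (a : Fin (suc (suc k))) (i j : Fin 3) → i ≢ j
    → ((+ 3 / 1) * density P) - (+ 2 / 1) ≤ egood P i j a
claim2p1 k P density-drops a i j i≢j =
  affine-/-≤ 3 2 (size P) (suc (suc k) ℕ.^ 3) (dgood P i j a) (suc (suc k))
    (density-drop⇒3*S*n≤D*n³+2*n³*n (suc k) (size P) (size (remove P a)) (dgood P i j a)
      (/<⇒*< (size (remove P a)) (suc k ℕ.^ 3) (size P) (suc (suc k) ℕ.^ 3) (density-drops a))
      (size-≤-remove P a i j i≢j)
      (size≤n³ P))
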